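{- Let $(C_n,\lambda,\Delta)$ be a $\Delta$-periodic temporal graph whose underlying graph is the cycle $C_n$ with vertices $v_1,\dots,v_n$ and edges $v_iv_{i+1}$ (indices modulo $n$). Let $v_i,v_j$ be vertices. If a fastest temporal path from $v_i$ to $v_j$ uses the positive side of the cycle, i.e. has underlying path $v_i,v_{i+1},\dots,v_{j-1},v_j$ (resp. the negative side $v_i,v_{i-1},\dots,v_{j+1},v_j$), then for every $k\in\{i+1,i+2,\dots,j-1\}$ (resp. $k\in\{i-1,i-2,\dots,j+1\}$), indices modulo $n$, a fastest temporal path from $v_i$ to $v_k$ uses the same (positive, resp. negative) side of the cycle.
   Context: A $\Delta$-periodic temporal graph $(G,\lambda,\Delta)$ consists of a static undirected graph $G=(V,E)$, a positive integer $\Delta$ and a labeling $\lambda: E \to \{1,\dots,\Delta\}$; edge $e$ is available exactly at the times $\lambda(e)+i\Delta$ for integers $i\geq 0$. A temporal path from $u$ to $v$ is a sequence $(e_1,t_1),\dots,(e_k,t_k)$ where $(e_1,\dots,e_k)$ is a path from $u$ to $v$ in $G$, each $t_i$ is a time at which $e_i$ is available, and $t_1<\dots<t_k$; its duration is $t_k-t_1+1$. A fastest temporal path from $u$ to $v$ is one of minimum duration. In a cycle, the only two paths between two distinct vertices are the one along the positive side and the one along the negative side. -}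

module Defs where

open import Data.Nat using (ℕ; zero; suc; _+_; _*_; _∸_; _≤_; _<_; NonZero)
open import Data.Nat.DivMod using (_mod_)
open import Data.Fin using (Fin; toℕ)
open import Data.List using (List; []; _∷_; map; upTo; last)
open import Data.List.Relation.Unary.Unique.Propositional using (Unique)
open import Data.Maybe using (Maybe; just; nothing)
open import Data.Product using (_×_; _,_; ∃-syntax; proj₁)
open import Data.Sum using (_⊎_)
open import Data.Unit using (⊤)
open import Relation.Binary.PropositionalEquality using (_≡_)

data Side : Set where
  positive negative : Side

-- A Δ-periodic temporal graph on the cycle C_n with vertices v_0 … v_{n-1}
-- (Fin n) and edges e_i = v_i v_{i+1 mod n}; the label of e_i is lab i.
module Cycle (n : ℕ) .{{_ : NonZero n}} (Δ : ℕ) (lab : Fin n → ℕ) where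

  shift : Fin n → ℕ → Fin n
  shift i r = (toℕ i + r) mod n

  -- v_{i - r} (indices modulo n), for r ≤ n
  unshift : Fin n → ℕ → Fin n
  unshift i r = (toℕ i + (n ∸ r)) mod n

  next : Fin n → Fin n
  next i = shift i 1

  EdgeBetween : Fin n → Fin n → Fin n → Set
  EdgeBetween e x y = (x ≡ e × y ≡ next e) ⊎ (y ≡ e × x ≡ next e)

  Available : Fin n → ℕ → Set
  Available e t = ∃[ i ] t ≡ lab e + i * Δ

  -- Steps (x_1,t_1),…,(x_k,t_k) starting from vertex x, each time strictly
  -- larger than the previous one (lo is the previous time; for the first step
  -- lo = 0, which is vacuous since every availability time is ≥ 1).
  ValidSteps : Fin n → ℕ → List (Fin n × ℕ) → Set
  ValidSteps x lo [] = ⊤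
  ValidSteps x lo ((y , t) ∷ rest) =
    (∃[ e ] (EdgeBetween e x y × Available e t)) × lo < t × ValidSteps y t rest

  endpoint : Fin n → List (Fin n × ℕ) → Fin n
  endpoint u hops with last (map proj₁ hops)
  ... | just v = v
  ... | nothing = u

  -- A temporal path from u to v, written as the list of pairs (x_r , t_r)
  -- where x_r is the vertex reached by the r-th edge (taken at time t_r);
  -- the underlying vertex sequence u, x_1, …, x_k must be a path (distinct).
  IsTemporalPath : Fin n → Fin n → List (Fin n × ℕ) → Set
  IsTemporalPath u v hops =
    ValidSteps u 0 hops × Unique (u ∷ map proj₁ hops) × endpoint u hops ≡ v

  firstTime : List (Fin n × ℕ) → ℕ
  firstTime [] = 0
  firstTime ((_ , t) ∷ _) = t

  lastTime : List (Fin n × ℕ) → ℕ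
  lastTime [] = 0
  lastTime ((_ , t) ∷ []) = t
  lastTime (_ ∷ h ∷ rest) = lastTime (h ∷ rest)

  duration : List (Fin n × ℕ) → ℕ
  duration hops = suc (lastTime hops ∸ firstTime hops)

  IsFastest : Fin n → Fin n → List (Fin n × ℕ) → Set
  IsFastest u v hops =
    IsTemporalPath u v hops ×
    (∀ hops′ → IsTemporalPath u v hops′ → duration hops ≤ duration hops′)

  distPos : Fin n → Fin n → ℕ
  distPos u v = toℕ ((toℕ v + (n ∸ toℕ u)) mod n)

  dist : Side → Fin n → Fin n → ℕ
  dist positive u v = distPos u v
  dist negative u v = distPos v u

  step : Side → Fin n → ℕ → Fin n
  step positive u r = shift u r
  step negative u r = unshift u r

  sideVertices : Side → Fin n → Fin n → List (Fin n)
  sideVertices s u v = map (λ r → step s u (suc r)) (upTo (dist s u v))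

  UsesSide : Side → Fin n → Fin n → List (Fin n × ℕ) → Set
  UsesSide s u v hops = map proj₁ hops ≡ sideVertices s u v

{-# OPTIONS --safe #-}
-- Write u_0 = v_i, u_1, u_2, … for the vertices along the side s. The greedy walk crosses
-- u_0u_1 at λ(u_0u_1) and every later edge u_tu_{t+1} at its first availability after the
-- previous crossing. Any temporal path along the side departs some c periods after the greedy
-- walk, and inductively each of its crossings is then at least c periods after the greedy one;
-- so the greedy walk to u_r is at least as fast as every path along the side reaching u_r or
-- beyond. Let 0 < r < d, where u_d = v_j. A path to u_r along the side s is thus no faster than
-- the greedy one. A path to u_r along the other side passes through v_j, so it is no faster than
-- the greedy walk to v_j along that side, hence no faster than the fastest path to v_j, which
-- runs along s through u_r and so is no faster than the greedy walk to u_r.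
module Submission where

open import Defs
open import Data.Nat
open import Data.Nat.Properties
open import Data.Nat.DivMod
open import Data.Nat.Tactic.RingSolver using (solve-∀)
open import Data.Fin using (Fin; toℕ)
import Data.Fin as Fin
open import Data.Fin.Properties using (toℕ-injective; toℕ<n; toℕ-fromℕ<)
open import Level using (0ℓ)
open import Relation.Binary.Bundles using (Setoid)
open import Relation.Binary.Structures using (IsEquivalence)
import Relation.Binary.Reasoning.Setoid as SetoidReasoning
open import Data.Product using (_×_; _,_; ∃-syntax; proj₁; proj₂; uncurry)
open import Data.Sum using (_⊎_; inj₁; inj₂; swap)
open import Data.Empty using (⊥-elim)
open import Data.List using (List; []; _∷_; map; length; last; applyUpTo)
open import Data.List.Properties using (∷-injective; map-upTo)
open import Data.List.Relation.Unary.All using (All; []; _∷_; tail)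
open import Data.List.Relation.Unary.AllPairs using ([]; _∷_)
open import Data.List.Relation.Unary.Unique.Propositional using (Unique)
open import Data.Maybe using (just)
open import Relation.Nullary using (yes; no)
open import Relation.Binary.PropositionalEquality

segment : {A : Set} → (ℕ → A) → ℕ → ℕ → List A
segment f o zero = []
segment f o (suc L) = f o ∷ segment f (suc o) L

All-segment⁺ : ∀ {A : Set} {P : A → Set} (f : ℕ → A) o L →
  (∀ t → t < L → P (f (o + t))) → All P (segment f o L)
All-segment⁺ f o zero Pf = []
All-segment⁺ {P = P} f o (suc L) Pf =
  subst P (cong f (+-identityʳ o)) (Pf 0 z<s) ∷
  All-segment⁺ f (suc o) L (λ t t<L → subst P (cong f (+-suc o t)) (Pf (suc t) (s<s t<L)))

All-segment⁻ : ∀ {A : Set} {P : A → Set} (f : ℕ → A) o L →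
  All P (segment f o L) → ∀ t → t < L → P (f (o + t))
All-segment⁻ {P = P} f o (suc L) (Pfo ∷ _) zero _ = subst P (cong f (sym (+-identityʳ o))) Pfo
All-segment⁻ {P = P} f o (suc L) (_ ∷ Pfs) (suc t) (s<s t<L) =
  subst P (cong f (sym (+-suc o t))) (All-segment⁻ f (suc o) L Pfs t t<L)

last-segment : ∀ {A : Set} (f : ℕ → A) o L → last (segment f o (suc L)) ≡ just (f (o + L))
last-segment f o zero = cong (λ x → just (f x)) (sym (+-identityʳ o))
last-segment f o (suc L) = trans (last-segment f (suc o) L) (cong (λ x → just (f x)) (sym (+-suc o L)))

applyUpTo-segment : ∀ {A : Set} (f g : ℕ → A) o L →
  (∀ t → t < L → f t ≡ g (o + t)) → applyUpTo f L ≡ segment g o L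
applyUpTo-segment f g o zero f≡g = refl
applyUpTo-segment f g o (suc L) f≡g = cong₂ _∷_ (trans (f≡g 0 z<s) (cong g (+-identityʳ o)))
  (applyUpTo-segment (λ t → f (suc t)) g (suc o) L
    (λ t t<L → trans (f≡g (suc t) (s<s t<L)) (cong g (+-suc o t))))

module Congruence (m : ℕ) where

  N : ℕ
  N = suc m

  infix 4 _≈_
  record _≈_ (a b : ℕ) : Set where
    constructor mk≈
    field remainders : a % N ≡ b % N

  ≈-isEquivalence : IsEquivalence _≈_
  ≈-isEquivalence = record
    { refl = mk≈ refl
    ; sym = λ (mk≈ e) → mk≈ (sym e)
    ; trans = λ (mk≈ e) (mk≈ f) → mk≈ (trans e f) }

  ≈-setoid : Setoid 0ℓ 0ℓ
  ≈-setoid = record { isEquivalence = ≈-isEquivalence }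

  module ≈-Reasoning = SetoidReasoning ≈-setoid

  +-congʳ : ∀ {a b} c → a ≈ b → a + c ≈ b + c
  +-congʳ {a} {b} c (mk≈ e) = mk≈ (begin
    (a + c) % N             ≡⟨ %-distribˡ-+ a c N ⟩
    (a % N + c % N) % N     ≡⟨ cong (λ x → (x + c % N) % N) e ⟩
    (b % N + c % N) % N     ≡⟨ %-distribˡ-+ b c N ⟨
    (b + c) % N             ∎)
    where open ≡-Reasoning

  +-congˡ : ∀ {a b} c → a ≈ b → c + a ≈ c + b
  +-congˡ {a} {b} c a≈b = begin
    c + a   ≡⟨ +-comm c a ⟩
    a + c   ≈⟨ +-congʳ c a≈b ⟩
    b + c   ≡⟨ +-comm b c ⟩
    c + b   ∎
    where open ≈-Reasoning

  m+k*N≈m : ∀ a k → a + k * N ≈ a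
  m+k*N≈m a k = mk≈ ([m+kn]%n≡m%n a k N)

  m+N≈m : ∀ a → a + N ≈ a
  m+N≈m a = mk≈ ([m+n]%n≡m%n a N)

  +-cancelʳ : ∀ {a b} c → a + c ≈ b + c → a ≈ b
  +-cancelʳ {a} {b} c a+c≈b+c = begin
    a                   ≈⟨ m+k*N≈m a c ⟨
    a + c * N           ≡⟨ split a ⟩
    (a + c) + c * m     ≈⟨ +-congʳ (c * m) a+c≈b+c ⟩
    (b + c) + c * m     ≡⟨ split b ⟨
    b + c * N           ≈⟨ m+k*N≈m b c ⟩
    b                   ∎
    where
    split : ∀ x → x + c * N ≡ (x + c) + c * m
    split x = trans (cong (x +_) (*-suc c m)) (sym (+-assoc x c (c * m)))
    open ≈-Reasoning

  +-cancelˡ : ∀ {a b} c → c + a ≈ c + b → a ≈ b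
  +-cancelˡ {a} {b} c c+a≈c+b = +-cancelʳ c (begin
    a + c   ≡⟨ +-comm a c ⟩
    c + a   ≈⟨ c+a≈c+b ⟩
    c + b   ≡⟨ +-comm c b ⟩
    b + c   ∎)
    where open ≈-Reasoning

  ≈⇒≡ : ∀ {a b} → a < N → b < N → a ≈ b → a ≡ b
  ≈⇒≡ a<N b<N (mk≈ e) = trans (sym (m<n⇒m%n≡m a<N)) (trans e (m<n⇒m%n≡m b<N))

  toℕ-mod : ∀ a → toℕ (a mod N) ≡ a % N
  toℕ-mod a = toℕ-fromℕ< (m%n<n a N)

  toℕ-mod≈ : ∀ a → toℕ (a mod N) ≈ a
  toℕ-mod≈ a = mk≈ (trans (cong (_% N) (toℕ-mod a)) (m%n%n≡m%n a N))

  mod-cong : ∀ {a b} → a ≈ b → a mod N ≡ b mod N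
  mod-cong {a} {b} (mk≈ e) = toℕ-injective (trans (toℕ-mod a) (trans e (sym (toℕ-mod b))))

  mod-injective : ∀ {a b} → a mod N ≡ b mod N → a ≈ b
  mod-injective {a} {b} e = mk≈ (trans (sym (toℕ-mod a)) (trans (cong toℕ e) (toℕ-mod b)))

  toℕ-≈-injective : ∀ {x y : Fin N} → toℕ x ≈ toℕ y → x ≡ y
  toℕ-≈-injective {x} {y} e = toℕ-injective (≈⇒≡ (toℕ<n x) (toℕ<n y) e)

  toℕ-mod-inverse : ∀ (x : Fin N) → toℕ x mod N ≡ x
  toℕ-mod-inverse x = toℕ-≈-injective (toℕ-mod≈ (toℕ x))

module CycleArithmetic (m : ℕ) (Δ : ℕ) (lab : Fin (suc m) → ℕ) where
  open Congruence m public
  open Cycle N Δ lab public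
  open ≈-Reasoning

  -- v_{i-t}, computed as v_{i+t(N-1)}: unlike unshift it needs no truncated subtraction, so it is valid for all t.
  back : Fin N → ℕ → Fin N
  back i t = (toℕ i + t * m) mod N

  toℕ-next : ∀ x → toℕ (next x) ≈ toℕ x + 1
  toℕ-next x = toℕ-mod≈ (toℕ x + 1)

  next-injective : ∀ {x y} → next x ≡ next y → x ≡ y
  next-injective e = toℕ-≈-injective (+-cancelʳ 1 (mod-injective e))

  x≢next²x : 2 ≤ m → ∀ x → x ≢ next (next x)
  x≢next²x 2≤m x x≡next²x = 0≢1+n (≈⇒≡ (s≤s z≤n) (s≤s 2≤m) (+-cancelʳ (toℕ x) 0+x≈2+x))
    where
    0+x≈2+x : 0 + toℕ x ≈ 2 + toℕ x
    0+x≈2+x = begin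
      toℕ x                   ≡⟨ cong toℕ x≡next²x ⟩
      toℕ (next (next x))     ≈⟨ toℕ-next (next x) ⟩
      toℕ (next x) + 1        ≈⟨ +-congʳ 1 (toℕ-next x) ⟩
      toℕ x + 1 + 1           ≡⟨ +-comm (toℕ x + 1) 1 ⟩
      suc (toℕ x + 1)         ≡⟨ cong suc (+-comm (toℕ x) 1) ⟩
      2 + toℕ x               ∎

  next-shift : ∀ i t → next (shift i t) ≡ shift i (suc t)
  next-shift i t = mod-cong (begin
    toℕ (shift i t) + 1   ≈⟨ +-congʳ 1 (toℕ-mod≈ (toℕ i + t)) ⟩
    toℕ i + t + 1         ≡⟨ assoc ⟩
    toℕ i + suc t         ∎)
    where
    assoc : toℕ i + t + 1 ≡ toℕ i + suc t
    assoc = trans (+-assoc (toℕ i) t 1) (cong (toℕ i +_) (+-comm t 1))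

  next-back : ∀ i t → next (back i (suc t)) ≡ back i t
  next-back i t = mod-cong (begin
    toℕ (back i (suc t)) + 1     ≈⟨ +-congʳ 1 (toℕ-mod≈ (toℕ i + suc t * m)) ⟩
    toℕ i + suc t * m + 1        ≡⟨ regroup (toℕ i) t m ⟩
    toℕ i + t * m + N            ≈⟨ m+N≈m (toℕ i + t * m) ⟩
    toℕ i + t * m                ∎)
    where
    regroup : ∀ x t k → x + suc t * k + 1 ≡ x + t * k + suc k
    regroup = solve-∀

  shift-∸ : ∀ i t → t ≤ N → shift i (N ∸ t) ≡ back i t
  shift-∸ i t t≤N = mod-cong (+-cancelʳ t (begin
    toℕ i + (N ∸ t) + t       ≡⟨ +-assoc (toℕ i) (N ∸ t) t ⟩
    toℕ i + (N ∸ t + t)       ≡⟨ cong (toℕ i +_) (m∸n+n≡m t≤N) ⟩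
    toℕ i + N                 ≈⟨ m+N≈m (toℕ i) ⟩
    toℕ i                     ≈⟨ m+k*N≈m (toℕ i) t ⟨
    toℕ i + t * N             ≡⟨ regroup (toℕ i) t m ⟨
    toℕ i + t * m + t         ∎))
    where
    regroup : ∀ x u k → x + u * k + u ≡ x + u * suc k
    regroup = solve-∀

  back-∸ : ∀ i t → t ≤ N → back i (N ∸ t) ≡ shift i t
  back-∸ i t t≤N = trans (sym (shift-∸ i (N ∸ t) (m∸n≤m N t))) (cong (shift i) (m∸[m∸n]≡n t≤N))

  shift-0 : ∀ i → shift i 0 ≡ i
  shift-0 i = trans (cong (_mod N) (+-identityʳ (toℕ i))) (toℕ-mod-inverse i)

  back-0 : ∀ i → back i 0 ≡ i
  back-0 = shift-0

  shift-N : ∀ i → shift i N ≡ shift i 0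
  shift-N i = mod-cong (begin
    toℕ i + N   ≈⟨ m+N≈m (toℕ i) ⟩
    toℕ i       ≡⟨ +-identityʳ (toℕ i) ⟨
    toℕ i + 0   ∎)

  back-N : ∀ i → back i N ≡ back i 0
  back-N i = trans (sym (shift-∸ i N ≤-refl)) (cong (shift i) (n∸n≡0 N))

  shift-injective : ∀ i {a b} → a < N → b < N → shift i a ≡ shift i b → a ≡ b
  shift-injective i a<N b<N e = ≈⇒≡ a<N b<N (+-cancelˡ (toℕ i) (mod-injective e))

  back-injective : ∀ i {a b} → a < N → b < N → back i a ≡ back i b → a ≡ b
  back-injective i {a} {b} a<N b<N e = sym (≈⇒≡ b<N a<N (+-cancelˡ (toℕ i) (begin
    toℕ i + b                         ≈⟨ m+k*N≈m (toℕ i + b) a ⟨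
    toℕ i + b + a * N                 ≡⟨ regroup (toℕ i) a b m ⟩
    (toℕ i + a * m) + (a + b)         ≈⟨ +-congʳ (a + b) (mod-injective {toℕ i + a * m} {toℕ i + b * m} e) ⟩
    (toℕ i + b * m) + (a + b)         ≡⟨ regroup′ (toℕ i) a b m ⟩
    toℕ i + a + b * N                 ≈⟨ m+k*N≈m (toℕ i + a) b ⟩
    toℕ i + a                         ∎)))
    where
    regroup : ∀ x a b k → x + b + a * suc k ≡ (x + a * k) + (a + b)
    regroup = solve-∀
    regroup′ : ∀ x a b k → (x + b * k) + (a + b) ≡ x + a + b * suc k
    regroup′ = solve-∀

  distPos-shift : ∀ i r → r < N → distPos i (shift i r) ≡ r
  distPos-shift i r r<N = ≈⇒≡ (toℕ<n _) r<N (begin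
    toℕ ((toℕ (shift i r) + (N ∸ toℕ i)) mod N)   ≈⟨ toℕ-mod≈ _ ⟩
    toℕ (shift i r) + (N ∸ toℕ i)                 ≈⟨ +-congʳ (N ∸ toℕ i) (toℕ-mod≈ (toℕ i + r)) ⟩
    toℕ i + r + (N ∸ toℕ i)                       ≡⟨ regroup (toℕ i) r (N ∸ toℕ i) ⟩
    r + (toℕ i + (N ∸ toℕ i))                     ≡⟨ cong (r +_) (m+[n∸m]≡n (<⇒≤ (toℕ<n i))) ⟩
    r + N                                         ≈⟨ m+N≈m r ⟩
    r                                             ∎)
    where
    regroup : ∀ x r u → x + r + u ≡ r + (x + u)
    regroup = solve-∀

  distPos-back : ∀ i r → r < N → distPos (back i r) i ≡ r
  distPos-back i r r<N = ≈⇒≡ (toℕ<n _) r<N (+-cancelʳ (toℕ k) (begin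
    toℕ ((toℕ i + (N ∸ toℕ k)) mod N) + toℕ k   ≈⟨ +-congʳ (toℕ k) (toℕ-mod≈ _) ⟩
    toℕ i + (N ∸ toℕ k) + toℕ k                 ≡⟨ +-assoc (toℕ i) (N ∸ toℕ k) (toℕ k) ⟩
    toℕ i + (N ∸ toℕ k + toℕ k)                 ≡⟨ cong (toℕ i +_) (m∸n+n≡m (<⇒≤ (toℕ<n k))) ⟩
    toℕ i + N                                   ≈⟨ m+N≈m (toℕ i) ⟩
    toℕ i                                       ≈⟨ m+k*N≈m (toℕ i) r ⟨
    toℕ i + r * N                               ≡⟨ regroup (toℕ i) r m ⟩
    r + (toℕ i + r * m)                         ≈⟨ +-congˡ r (toℕ-mod≈ (toℕ i + r * m)) ⟨
    r + toℕ k                                   ∎))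
    where
    k = back i r
    regroup : ∀ x r k → x + r * suc k ≡ r + (x + r * k)
    regroup = solve-∀

module Paths (m δ : ℕ) (lab : Fin (suc m) → ℕ)
             (lab-bounds : ∀ e → 1 ≤ lab e × lab e ≤ suc δ) (2≤m : 2 ≤ m) where
  open CycleArithmetic m (suc δ) lab public

  Δ : ℕ
  Δ = suc δ

  firstAvailableAfter : Fin N → ℕ → ℕ
  firstAvailableAfter e lo with lo <? lab e
  ... | yes _ = lab e
  ... | no _  = lab e + suc ((lo ∸ lab e) / Δ) * Δ

  firstAvailableAfter-0 : ∀ e → firstAvailableAfter e 0 ≡ lab e
  firstAvailableAfter-0 e with 0 <? lab e
  ... | yes _ = refl
  ... | no 0≮lab = ⊥-elim (0≮lab (proj₁ (lab-bounds e)))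

  firstAvailableAfter-available : ∀ e lo → Available e (firstAvailableAfter e lo)
  firstAvailableAfter-available e lo with lo <? lab e
  ... | yes _ = 0 , sym (+-identityʳ (lab e))
  ... | no _  = suc ((lo ∸ lab e) / Δ) , refl

  firstAvailableAfter-> : ∀ e lo → lo < firstAvailableAfter e lo
  firstAvailableAfter-> e lo with lo <? lab e
  ... | yes lo<lab = lo<lab
  ... | no lo≮lab = begin-strict
      lo                            ≡⟨ m+[n∸m]≡n (≮⇒≥ lo≮lab) ⟨
      lab e + a                     ≡⟨ cong (lab e +_) (m≡m%n+[m/n]*n a Δ) ⟩
      lab e + (a % Δ + a / Δ * Δ)   <⟨ +-monoʳ-< (lab e) (+-monoˡ-< (a / Δ * Δ) (m%n<n a Δ)) ⟩
      lab e + suc (a / Δ) * Δ       ∎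
    where
    open ≤-Reasoning
    a = lo ∸ lab e

  firstAvailableAfter-least : ∀ e {lo s} → Available e s → lo < s → firstAvailableAfter e lo ≤ s
  firstAvailableAfter-least e {lo} (k , refl) lo<s with lo <? lab e
  ... | yes _ = m≤m+n (lab e) (k * Δ)
  ... | no lo≮lab = +-monoʳ-≤ (lab e) (*-monoˡ-≤ Δ (m<n*o⇒m/o<n {n = k} a<kΔ))
    where
    a<kΔ : lo ∸ lab e < k * Δ
    a<kΔ = +-cancelˡ-< (lab e) _ _ (subst (_< lab e + k * Δ) (sym (m+[n∸m]≡n (≮⇒≥ lo≮lab))) lo<s)

  firstAvailableAfter-periodic : ∀ e {lo s} c → Available e s → c * Δ + lo < s →
    c * Δ + firstAvailableAfter e lo ≤ s
  firstAvailableAfter-periodic e {lo} c (k , refl) c*Δ+lo<s = begin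
    c * Δ + firstAvailableAfter e lo   ≤⟨ +-monoʳ-≤ (c * Δ) (firstAvailableAfter-least e (k ∸ c , refl) lo<s′) ⟩
    c * Δ + (lab e + (k ∸ c) * Δ)     ≡⟨ c*Δ+s′≡s ⟩
    lab e + k * Δ                     ∎
    where
    open ≤-Reasoning
    c≤k : c ≤ k
    c≤k = m<1+n⇒m≤n (*-cancelʳ-< Δ c (suc k) (begin-strict
      c * Δ           ≤⟨ m≤m+n (c * Δ) lo ⟩
      c * Δ + lo      <⟨ c*Δ+lo<s ⟩
      lab e + k * Δ   ≤⟨ +-monoˡ-≤ (k * Δ) (proj₂ (lab-bounds e)) ⟩
      suc k * Δ       ∎))
    c*Δ+s′≡s : c * Δ + (lab e + (k ∸ c) * Δ) ≡ lab e + k * Δ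
    c*Δ+s′≡s = begin-equality
      c * Δ + (lab e + (k ∸ c) * Δ)   ≡⟨ +-comm (c * Δ) _ ⟩
      lab e + (k ∸ c) * Δ + c * Δ     ≡⟨ +-assoc (lab e) _ _ ⟩
      lab e + ((k ∸ c) * Δ + c * Δ)   ≡⟨ cong (lab e +_) (*-distribʳ-+ Δ (k ∸ c) c) ⟨
      lab e + (k ∸ c + c) * Δ         ≡⟨ cong (λ x → lab e + x * Δ) (m∸n+n≡m c≤k) ⟩
      lab e + k * Δ                   ∎
    lo<s′ : lo < lab e + (k ∸ c) * Δ
    lo<s′ = +-cancelˡ-< (c * Δ) _ _ (subst (c * Δ + lo <_) (sym c*Δ+s′≡s) c*Δ+lo<s)

  record CycleWalk : Set where
    field
      vertex : ℕ → Fin N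
      edge : ℕ → Fin N
      edge-between : ∀ t → EdgeBetween (edge t) (vertex t) (vertex (suc t))
      edge-unique : ∀ t e → EdgeBetween e (vertex t) (vertex (suc t)) → e ≡ edge t
      injective : ∀ a b → a < N → b < N → vertex a ≡ vertex b → a ≡ b
      neighbours : ∀ t e z → EdgeBetween e (vertex (suc t)) z → z ≡ vertex (suc (suc t)) ⊎ z ≡ vertex t
      periodic : vertex N ≡ vertex 0

  EdgeBetween-next : ∀ {e x z} → EdgeBetween e x z → z ≡ next x ⊎ x ≡ next z
  EdgeBetween-next (inj₁ (refl , z≡next)) = inj₁ z≡next
  EdgeBetween-next (inj₂ (refl , x≡next)) = inj₂ x≡next

  positiveWalk : Fin N → CycleWalk
  positiveWalk i = record
    { vertex = shift i
    ; edge = shift i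
    ; edge-between = λ t → inj₁ (refl , sym (next-shift i t))
    ; edge-unique = unique
    ; injective = λ a b → shift-injective i
    ; neighbours = neighbours
    ; periodic = shift-N i
    }
    where
    unique : ∀ t e → EdgeBetween e (shift i t) (shift i (suc t)) → e ≡ shift i t
    unique t e (inj₁ (x≡e , _)) = sym x≡e
    unique t e (inj₂ (y≡e , x≡next)) = ⊥-elim (x≢next²x 2≤m (shift i t)
      (trans x≡next (cong next (trans (sym y≡e) (sym (next-shift i t))))))
    neighbours : ∀ t e z → EdgeBetween e (shift i (suc t)) z → z ≡ shift i (suc (suc t)) ⊎ z ≡ shift i t
    neighbours t e z e-between with EdgeBetween-next e-between
    ... | inj₁ z≡next = inj₁ (trans z≡next (next-shift i (suc t)))
    ... | inj₂ x≡next = inj₂ (next-injective (trans (sym x≡next) (sym (next-shift i t))))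

  negativeWalk : Fin N → CycleWalk
  negativeWalk i = record
    { vertex = back i
    ; edge = λ t → back i (suc t)
    ; edge-between = λ t → inj₂ (refl , sym (next-back i t))
    ; edge-unique = unique
    ; injective = λ a b → back-injective i
    ; neighbours = neighbours
    ; periodic = back-N i
    }
    where
    unique : ∀ t e → EdgeBetween e (back i t) (back i (suc t)) → e ≡ back i (suc t)
    unique t e (inj₂ (y≡e , _)) = sym y≡e
    unique t e (inj₁ (x≡e , y≡next)) = ⊥-elim (x≢next²x 2≤m (back i t)
      (trans (sym (next-back i t)) (cong next (trans y≡next (cong next (sym x≡e))))))
    neighbours : ∀ t e z → EdgeBetween e (back i (suc t)) z → z ≡ back i (suc (suc t)) ⊎ z ≡ back i t
    neighbours t e z e-between with EdgeBetween-next e-between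
    ... | inj₁ z≡next = inj₂ (trans z≡next (next-back i t))
    ... | inj₂ x≡next = inj₁ (next-injective (trans (sym x≡next) (sym (next-back i (suc t)))))

  neighbours-start : ∀ i e z → EdgeBetween e i z → z ≡ shift i 1 ⊎ z ≡ back i 1
  neighbours-start i e z e-between with EdgeBetween-next e-between
  ... | inj₁ z≡next = inj₁ z≡next
  ... | inj₂ i≡next = inj₂ (next-injective (trans (sym i≡next) (trans (sym (back-0 i)) (sym (next-back i 0)))))

  endpoint-last : ∀ u hops {v} → last (map proj₁ hops) ≡ just v → endpoint u hops ≡ v
  endpoint-last u hops eq with last (map proj₁ hops) | eq
  ... | just _ | refl = refl

  lastTime-≥ : ∀ {x} y s rest → ValidSteps x s rest → s ≤ lastTime ((y , s) ∷ rest)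
  lastTime-≥ y s [] _ = ≤-refl
  lastTime-≥ y s ((z , t) ∷ rest) (_ , s<t , valid) = ≤-trans (<⇒≤ s<t) (lastTime-≥ z t rest valid)

  Follows : CycleWalk → List (Fin N × ℕ) → Set
  Follows W q = map proj₁ q ≡ segment (CycleWalk.vertex W) 1 (length q)

  module Along (W : CycleWalk) where
    open CycleWalk W

    segment-unique : ∀ o L → o + L ≤ N → Unique (segment vertex o L)
    segment-unique o zero _ = []
    segment-unique o (suc L) o+1+L≤N =
      All-segment⁺ vertex (suc o) L (λ t t<L eq → <-irrefl (injective o (suc o + t) o<N (1+o+t<N t t<L) eq) (s≤s (m≤m+n o t)))
      ∷ segment-unique (suc o) L 1+o+L≤N
      where
      1+o+L≤N : suc o + L ≤ N
      1+o+L≤N = subst (_≤ N) (+-suc o L) o+1+L≤N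
      o<N : o < N
      o<N = <-≤-trans (m<m+n o z<s) o+1+L≤N
      1+o+t<N : ∀ t → t < L → suc o + t < N
      1+o+t<N t t<L = <-≤-trans (s≤s (+-monoʳ-< o t<L)) 1+o+L≤N

    greedy : ℕ → ℕ → ℕ → List (Fin N × ℕ)
    greedy o lo zero = []
    greedy o lo (suc L) = (vertex (suc o) , τ) ∷ greedy (suc o) τ L
      where τ = firstAvailableAfter (edge o) lo

    greedy-vertices : ∀ o lo L → map proj₁ (greedy o lo L) ≡ segment vertex (suc o) L
    greedy-vertices o lo zero = refl
    greedy-vertices o lo (suc L) = cong (vertex (suc o) ∷_) (greedy-vertices (suc o) _ L)

    greedy-valid : ∀ o lo L → ValidSteps (vertex o) lo (greedy o lo L)
    greedy-valid o lo zero = _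
    greedy-valid o lo (suc L) =
      (edge o , edge-between o , firstAvailableAfter-available (edge o) lo) ,
      firstAvailableAfter-> (edge o) lo , greedy-valid (suc o) _ L

    greedy-isTemporalPath : ∀ L → 1 ≤ L → L < N → IsTemporalPath (vertex 0) (vertex L) (greedy 0 0 L)
    greedy-isTemporalPath (suc L) _ L<N =
      greedy-valid 0 0 (suc L) ,
      subst (λ xs → Unique (vertex 0 ∷ xs)) (sym (greedy-vertices 0 0 (suc L))) (segment-unique 0 (suc (suc L)) L<N) ,
      endpoint-last (vertex 0) (greedy 0 0 (suc L)) (trans (cong last (greedy-vertices 0 0 (suc L))) (last-segment vertex 1 L))

    segment-path-end : ∀ v q L → IsTemporalPath (vertex 0) v q → map proj₁ q ≡ segment vertex 1 L → 1 ≤ L →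
      L < N × vertex L ≡ v
    segment-path-end v q (suc L) (_ , unique , q-end) q-along _ = L<N , trans (sym q-end′) q-end
      where
      q-end′ : endpoint (vertex 0) q ≡ vertex (suc L)
      q-end′ = endpoint-last (vertex 0) q (trans (cong last q-along) (last-segment vertex 1 L))
      -- q cannot wrap around the cycle: vertex N = vertex 0 is already on it.
      L<N : suc L < N
      L<N with suc L <? N | subst (λ xs → Unique (vertex 0 ∷ xs)) q-along unique
      ... | yes L<N | _ = L<N
      ... | no L≮N | vertex0∉ ∷ _ = ⊥-elim (All-segment⁻ vertex 1 (suc L) vertex0∉ m (≮⇒≥ L≮N) (sym periodic))

    segment-path-length : ∀ r q → 0 < r → r < N → IsTemporalPath (vertex 0) (vertex r) q →
      Follows W q → length q ≡ r
    segment-path-length r [] 0<r r<N (_ , _ , q-end) _ = ⊥-elim (<-irrefl (injective 0 r z<s r<N q-end) 0<r)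
    segment-path-length r q@(_ ∷ _) 0<r r<N q-path q-along
      with segment-path-end (vertex r) q (length q) q-path q-along (s≤s z≤n)
    ... | L<N , q-end = injective (length q) r L<N r<N q-end

    greedy-lastTime-≤ : ∀ o τ c y s rest L L′ → ValidSteps (vertex (suc o)) s rest →
      map proj₁ rest ≡ segment vertex (suc (suc o)) L′ → L ≤ L′ → c * Δ + τ ≤ s →
      c * Δ + lastTime ((vertex (suc o) , τ) ∷ greedy (suc o) τ L) ≤ lastTime ((y , s) ∷ rest)
    greedy-lastTime-≤ o τ c y s rest zero L′ valid _ _ c*Δ+τ≤s = ≤-trans c*Δ+τ≤s (lastTime-≥ y s rest valid)
    greedy-lastTime-≤ o τ c y s ((y′ , s′) ∷ rest) (suc L) (suc L′)
      ((e , e-between , e-available) , s<s′ , valid) rest-along (s≤s L≤L′) c*Δ+τ≤s with ∷-injective rest-along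
    ... | refl , rest-along′ = greedy-lastTime-≤ (suc o) τ′ c y′ s′ rest L L′ valid rest-along′ L≤L′ c*Δ+τ′≤s′
      where
      τ′ = firstAvailableAfter (edge (suc o)) τ
      c*Δ+τ′≤s′ : c * Δ + τ′ ≤ s′
      c*Δ+τ′≤s′ = firstAvailableAfter-periodic (edge (suc o)) c
        (subst (λ x → Available x s′) (edge-unique (suc o) e e-between) e-available) (≤-<-trans c*Δ+τ≤s s<s′)

    greedy-duration-≤ : ∀ q L L′ → ValidSteps (vertex 0) 0 q → map proj₁ q ≡ segment vertex 1 L′ →
      1 ≤ L → L ≤ L′ → duration (greedy 0 0 L) ≤ duration q
    greedy-duration-≤ ((y , s) ∷ rest) (suc L) (suc L′) ((e , e-between , (c , s≡)) , _ , valid) q-along _ (s≤s L≤L′)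
      with ∷-injective q-along
    ... | refl , rest-along = s≤s (begin
      lastTime G ∸ τ₀                           ≡⟨ [m+n]∸[m+o]≡n∸o (c * Δ) (lastTime G) τ₀ ⟨
      (c * Δ + lastTime G) ∸ (c * Δ + τ₀)       ≤⟨ ∸-monoˡ-≤ (c * Δ + τ₀) G-shifted≤q ⟩
      lastTime ((y , s) ∷ rest) ∸ (c * Δ + τ₀)  ≡⟨ cong (lastTime ((y , s) ∷ rest) ∸_) s≡c*Δ+τ₀ ⟨
      lastTime ((y , s) ∷ rest) ∸ s             ∎)
      where
      open ≤-Reasoning
      τ₀ = firstAvailableAfter (edge 0) 0
      G = (vertex 1 , τ₀) ∷ greedy 1 τ₀ L
      s≡c*Δ+τ₀ : s ≡ c * Δ + τ₀
      s≡c*Δ+τ₀ = begin-equality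
        s                       ≡⟨ s≡ ⟩
        lab e + c * Δ           ≡⟨ cong (λ x → lab x + c * Δ) (edge-unique 0 e e-between) ⟩
        lab (edge 0) + c * Δ    ≡⟨ +-comm _ (c * Δ) ⟩
        c * Δ + lab (edge 0)    ≡⟨ cong (c * Δ +_) (firstAvailableAfter-0 (edge 0)) ⟨
        c * Δ + τ₀              ∎
      G-shifted≤q : c * Δ + lastTime G ≤ lastTime ((y , s) ∷ rest)
      G-shifted≤q = greedy-lastTime-≤ 0 τ₀ c y s rest L L′ valid rest-along L≤L′ (≤-reflexive (sym s≡c*Δ+τ₀))

    greedy-duration-≤-follower : ∀ L r q → 1 ≤ L → L ≤ r → r < N → IsTemporalPath (vertex 0) (vertex r) q →
      Follows W q → duration (greedy 0 0 L) ≤ duration q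
    greedy-duration-≤-follower L r q 1≤L L≤r r<N q-path q-along =
      greedy-duration-≤ q L (length q) (proj₁ q-path) q-along 1≤L
        (subst (L ≤_) (sym (segment-path-length r q (≤-trans 1≤L L≤r) r<N q-path q-along)) L≤r)

    path-follows : ∀ o lo rest → ValidSteps (vertex (suc o)) lo rest → Unique (vertex (suc o) ∷ map proj₁ rest) →
      All (vertex o ≢_) (map proj₁ rest) → map proj₁ rest ≡ segment vertex (suc (suc o)) (length rest)
    path-follows o lo [] _ _ _ = refl
    path-follows o lo ((z , t) ∷ rest) ((e , e-between , _) , _ , valid) (z∉ ∷ unique) (vertex-o≢z ∷ _)
      with neighbours o e z e-between
    ... | inj₂ z≡vertex-o = ⊥-elim (vertex-o≢z (sym z≡vertex-o))
    ... | inj₁ refl = cong (vertex (suc (suc o)) ∷_) (path-follows (suc o) t rest valid unique (tail z∉))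

  open CycleWalk public using (vertex)

  follows-one-of : (A B : CycleWalk) (i : Fin N) → vertex A 0 ≡ i → vertex B 0 ≡ i →
    (∀ e z → EdgeBetween e i z → z ≡ vertex A 1 ⊎ z ≡ vertex B 1) →
    ∀ q → ValidSteps i 0 q → Unique (i ∷ map proj₁ q) → Follows A q ⊎ Follows B q
  follows-one-of A B i A-start B-start first [] _ _ = inj₁ refl
  follows-one-of A B i A-start B-start first ((z , t) ∷ rest) ((e , e-between , _) , _ , valid) (i∉ ∷ unique)
    with first e z e-between
  ... | inj₁ refl = inj₁ (cong (vertex A 1 ∷_) (Along.path-follows A 0 t rest valid unique (subst (λ x → All (x ≢_) _) (sym A-start) (tail i∉))))
  ... | inj₂ refl = inj₂ (cong (vertex B 1 ∷_) (Along.path-follows B 0 t rest valid unique (subst (λ x → All (x ≢_) _) (sym B-start) (tail i∉))))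

  walk : Side → Fin N → CycleWalk
  walk positive = positiveWalk
  walk negative = negativeWalk

  opposite : Side → Side
  opposite positive = negative
  opposite negative = positive

  walk-0 : ∀ s i → vertex (walk s i) 0 ≡ i
  walk-0 positive = shift-0
  walk-0 negative = back-0

  walk-opposite : ∀ s i t → t ≤ N → vertex (walk (opposite s) i) (N ∸ t) ≡ vertex (walk s i) t
  walk-opposite positive = back-∸
  walk-opposite negative = shift-∸

  follows-side : ∀ s i q → ValidSteps i 0 q → Unique (i ∷ map proj₁ q) →
    Follows (walk s i) q ⊎ Follows (walk (opposite s) i) q
  follows-side positive i = follows-one-of (positiveWalk i) (negativeWalk i) i (shift-0 i) (back-0 i) (neighbours-start i)
  follows-side negative i q valid unique = swap (follows-side positive i q valid unique)

  step-walk : ∀ s i t → t ≤ N → step s i t ≡ vertex (walk s i) t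
  step-walk positive i t _ = refl
  step-walk negative i t = shift-∸ i t

  dist-step : ∀ s i r → r < N → dist s i (step s i r) ≡ r
  dist-step positive i r r<N = distPos-shift i r r<N
  dist-step negative i r r<N = trans (cong (λ x → distPos x i) (shift-∸ i r (<⇒≤ r<N))) (distPos-back i r r<N)

  dist<N : ∀ s u v → dist s u v < N
  dist<N positive u v = toℕ<n _
  dist<N negative u v = toℕ<n _

  sideVertices-walk : ∀ s i v → sideVertices s i v ≡ segment (vertex (walk s i)) 1 (dist s i v)
  sideVertices-walk s i v = trans (map-upTo _ (dist s i v)) (applyUpTo-segment _ (vertex (walk s i)) 1 (dist s i v)
    (λ t t<d → step-walk s i (suc t) (<-trans t<d (dist<N s i v))))

  greedy-isFastest : ∀ s i j p d → IsFastest i j p → map proj₁ p ≡ segment (vertex (walk s i)) 1 d → d < N →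
    ∀ r → 0 < r → r < d → IsFastest i (vertex (walk s i) r) (Along.greedy (walk s i) 0 0 r)
  greedy-isFastest s i j p d (p-path , p-fastest) p-along d<N r 0<r r<d = G-path , G-fastest
    where
    H = walk s i
    H̄ = walk (opposite s) i
    module H = Along H
    module H̄ = Along H̄
    r<N = <-trans r<d d<N
    from-start : ∀ W {v q} → vertex W 0 ≡ i → IsTemporalPath i v q → IsTemporalPath (vertex W 0) v q
    from-start W W-start = subst (λ u → IsTemporalPath u _ _) (sym W-start)
    G-path : IsTemporalPath i (vertex H r) (H.greedy 0 0 r)
    G-path = subst (λ u → IsTemporalPath u (vertex H r) (H.greedy 0 0 r)) (walk-0 s i) (H.greedy-isTemporalPath r 0<r r<N)
    j-on-H : vertex H d ≡ j
    j-on-H = proj₂ (H.segment-path-end j p d (from-start H (walk-0 s i) p-path) p-along (<-trans 0<r r<d))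
    1≤N∸d : 1 ≤ N ∸ d
    1≤N∸d = m<n⇒0<n∸m d<N
    Ḡ = H̄.greedy 0 0 (N ∸ d)
    Ḡ-path : IsTemporalPath i j Ḡ
    Ḡ-path = subst₂ (λ u v → IsTemporalPath u v Ḡ) (walk-0 (opposite s) i) (trans (walk-opposite s i d (<⇒≤ d<N)) j-on-H)
      (H̄.greedy-isTemporalPath (N ∸ d) 1≤N∸d (∸-monoʳ-< (<-trans 0<r r<d) (<⇒≤ d<N)))
    G≤p : duration (H.greedy 0 0 r) ≤ duration p
    G≤p = H.greedy-duration-≤ p r d (proj₁ (from-start H (walk-0 s i) p-path)) p-along 0<r (<⇒≤ r<d)
    G-fastest : ∀ q → IsTemporalPath i (vertex H r) q → duration (H.greedy 0 0 r) ≤ duration q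
    G-fastest q q-path with follows-side s i q (proj₁ q-path) (proj₁ (proj₂ q-path))
    ... | inj₁ q-along = H.greedy-duration-≤-follower r r q 0<r ≤-refl r<N (from-start H (walk-0 s i) q-path) q-along
    ... | inj₂ q-along = begin
      duration (H.greedy 0 0 r)   ≤⟨ G≤p ⟩
      duration p                  ≤⟨ p-fastest Ḡ Ḡ-path ⟩
      duration Ḡ                  ≤⟨ H̄.greedy-duration-≤-follower (N ∸ d) (N ∸ r) q 1≤N∸d
                                       (∸-monoʳ-≤ N (<⇒≤ r<d)) (∸-monoʳ-< 0<r (<⇒≤ r<N)) q-path̄ q-along ⟩
      duration q                  ∎
      where
      open ≤-Reasoning
      q-path̄ : IsTemporalPath (vertex H̄ 0) (vertex H̄ (N ∸ r)) q
      q-path̄ = from-start H̄ (walk-0 (opposite s) i)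
        (subst (λ v → IsTemporalPath i v q) (sym (walk-opposite s i r (<⇒≤ r<N))) q-path)

mainTheorem6 : (n : ℕ) .{{_ : NonZero n}} → 3 ≤ n →
    (Δ : ℕ) (lab : Fin n → ℕ) → (∀ e → 1 ≤ lab e × lab e ≤ Δ) →
    (s : Side) (i j : Fin n) → i ≢ j →
    (∃[ p ] (Cycle.IsFastest n Δ lab i j p × Cycle.UsesSide n Δ lab s i j p)) →
    (k : Fin n) → (∃[ r ] (0 < r × r < Cycle.dist n Δ lab s i j × k ≡ Cycle.step n Δ lab s i r)) →
    ∃[ q ] (Cycle.IsFastest n Δ lab i k q × Cycle.UsesSide n Δ lab s i k q)
mainTheorem6 (suc m) _ zero lab lab-bounds = ⊥-elim (<-irrefl refl (uncurry ≤-trans (lab-bounds Fin.zero)))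
mainTheorem6 (suc m) (s≤s 2≤m) (suc δ) lab lab-bounds s i j _ (p , p-fastest , p-side) k (r , 0<r , r<d , refl) =
  G , subst (λ v → IsFastest i v G) (sym (step-walk s i r (<⇒≤ r<N))) G-fastest , G-side
  where
  open Paths m δ lab lab-bounds 2≤m
  r<N = <-trans r<d (dist<N s i j)
  G = Along.greedy (walk s i) 0 0 r
  G-fastest : IsFastest i (vertex (walk s i) r) G
  G-fastest = greedy-isFastest s i j p (dist s i j) p-fastest (trans p-side (sideVertices-walk s i j)) (dist<N s i j) r 0<r r<d
  G-side : map proj₁ G ≡ sideVertices s i (step s i r)
  G-side = begin
    map proj₁ G                                           ≡⟨ Along.greedy-vertices (walk s i) 0 0 r ⟩
    segment (vertex (walk s i)) 1 r                       ≡⟨ cong (segment (vertex (walk s i)) 1) (dist-step s i r r<N) ⟨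
    segment (vertex (walk s i)) 1 (dist s i (step s i r)) ≡⟨ sideVertices-walk s i (step s i r) ⟨
    sideVertices s i (step s i r)                         ∎
    where open ≡-Reasoning
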